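{- Let $k$ be a field of characteristic $0$, let $\mathcal F=k\langle \mathbf c,\mathbf d\rangle$ be the free associative algebra (concatenation product, unit $1$) in non-commuting variables $\mathbf c,\mathbf d$, and let $\hat{\mathcal F}=k\,e\oplus\mathcal F$, where $e$ is a formal symbol. Let $\Delta:\mathcal F\to\mathcal F\otimes\mathcal F$ be the linear map determined by $\Delta(1)=0$, $\Delta(\mathbf c)=2(1\otimes 1)$, $\Delta(\mathbf d)=1\otimes\mathbf c+\mathbf c\otimes 1$ and $\Delta(uv)=\Delta(u)v+u\Delta(v)$ for $u,v\in\mathcal F$, where $(x\otimes y)v=x\otimes yv$ and $u(x\otimes y)=ux\otimes y$. Define $\hat\Delta:\hat{\mathcal F}\to\hat{\mathcal F}\otimes\hat{\mathcal F}$ by $\hat\Delta(e)=e\otimes e$ and $\hat\Delta(u)=\Delta(u)+e\otimes u+u\otimes e$ for $u\in\mathcal F$. Let $G:\mathcal F\to\mathcal F$ be the linear map determined by $G(1)=0$, $G(\mathbf c)=\mathbf d$, $G(\mathbf d)=\mathbf c\mathbf d$ and $G(uv)=G(u)v+uG(v)$, and define $\hat G:\hat{\mathcal F}\to\hat{\mathcal F}$ linearly by $\hat G(e)=1$ and $\hat G(u)=G(u)+u\mathbf c$ for $u\in\mathcal F$. Then $$\hat\Delta\circ\hat G=(\mathrm{id}\otimes\hat G+\hat G\otimes\mathrm{id})\circ\hat\Delta$$ as maps $\hat{\mathcal F}\to\hat{\mathcal F}\otimes\hat{\mathcal F}$; that is, $\hat G$ is a coderivation with respect to $\hat\Delta$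.
   Context: Degrees: $\deg\mathbf c=1$, $\deg\mathbf d=2$, $\deg e=-1$. The maps $\Delta$ and $G$ are well defined by the stated rules. -}

module Defs where

open import Level using (_⊔_)
open import Algebra.Bundles using (CommutativeRing)
open import Data.List using (List; []; _∷_; _++_; map; concatMap)
open import Data.List.Properties using (≡-dec)
open import Data.Maybe using (Maybe; nothing; just)
import Data.Maybe.Properties as MaybeP
open import Data.Product using (_×_; _,_; Σ)
import Data.Product.Properties as ProdP
open import Data.Nat using (ℕ; zero; suc)
open import Data.Bool using (if_then_else_)
open import Relation.Nullary using (¬_; yes; no; Dec; does)
open import Relation.Binary.PropositionalEquality using (_≡_; refl)
open import Relation.Binary.Definitions using (DecidableEquality)

data Letter : Set where
  𝐜 𝐝 : Letter

_≟L_ : DecidableEquality Letter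
𝐜 ≟L 𝐜 = yes refl
𝐜 ≟L 𝐝 = no λ ()
𝐝 ≟L 𝐜 = no λ ()
𝐝 ≟L 𝐝 = yes refl

-- Words = monomials = the standard basis of F = k⟨c,d⟩ (empty word = 1).
Word : Set
Word = List Letter

_≟W_ : DecidableEquality Word
_≟W_ = ≡-dec _≟L_

-- Basis of F̂ = k e ⊕ F : nothing ↦ e, just w ↦ w.
HatBasis : Set
HatBasis = Maybe Word

_≟H_ : DecidableEquality HatBasis
_≟H_ = MaybeP.≡-dec _≟W_

_≟HH_ : DecidableEquality (HatBasis × HatBasis)
_≟HH_ = ProdP.≡-dec _≟H_ _≟H_

module _ {c ℓ} (R : CommutativeRing c ℓ) where
  open CommutativeRing R

  IsField : Set (c ⊔ ℓ)
  IsField = (¬ (1# ≈ 0#)) × (∀ x → ¬ (x ≈ 0#) → Σ Carrier λ y → x * y ≈ 1#)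

  ℕ⟶R : ℕ → Carrier
  ℕ⟶R zero = 0#
  ℕ⟶R (suc n) = 1# + ℕ⟶R n

  CharZero : Set ℓ
  CharZero = ∀ n → ¬ (ℕ⟶R (suc n) ≈ 0#)

-- Free modules over R, represented by formal finite linear combinations of
-- basis elements; two such are equal iff all their coefficients agree.
module FreeAlg {c ℓ} (R : CommutativeRing c ℓ) where
  open CommutativeRing R

  Lin : Set → Set c
  Lin B = List (Carrier × B)

  coeff : {B : Set} → DecidableEquality B → Lin B → B → Carrier
  coeff _≟_ [] b = 0#
  coeff _≟_ ((r , b′) ∷ xs) b = (if does (b′ ≟ b) then r else 0#) + coeff _≟_ xs b

  scale : {B : Set} → Carrier → Lin B → Lin B
  scale r = map λ { (s , b) → (r * s , b) }

  mapB : {B B′ : Set} → (B → B′) → Lin B → Lin B′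
  mapB f = map λ { (s , b) → (s , f b) }

  ext : {B B′ : Set} → (B → Lin B′) → Lin B → Lin B′
  ext f = concatMap λ { (r , b) → scale r (f b) }

  two : Carrier
  two = 1# + 1#

  ΔL : Letter → Lin (Word × Word)
  ΔL 𝐜 = (two , ([] , [])) ∷ []
  ΔL 𝐝 = (1# , ([] , 𝐜 ∷ [])) ∷ (1# , (𝐜 ∷ [] , [])) ∷ []

  ΔW : Word → Lin (Word × Word)
  ΔW [] = []
  ΔW (x ∷ w) = mapB (λ { (a , b) → (a , b ++ w) }) (ΔL x)
            ++ mapB (λ { (a , b) → (x ∷ a , b) }) (ΔW w)

  GL : Letter → Lin Word
  GL 𝐜 = (1# , 𝐝 ∷ []) ∷ []
  GL 𝐝 = (1# , 𝐜 ∷ 𝐝 ∷ []) ∷ []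

  GW : Word → Lin Word
  GW [] = []
  GW (x ∷ w) = mapB (λ a → a ++ w) (GL x) ++ mapB (x ∷_) (GW w)

  ΔH : HatBasis → Lin (HatBasis × HatBasis)
  ΔH nothing = (1# , (nothing , nothing)) ∷ []
  ΔH (just w) = mapB (λ { (a , b) → (just a , just b) }) (ΔW w)
             ++ (1# , (nothing , just w)) ∷ (1# , (just w , nothing)) ∷ []

  GH : HatBasis → Lin HatBasis
  GH nothing = (1# , just []) ∷ []
  GH (just w) = mapB just (GW w) ++ (1# , just (w ++ 𝐜 ∷ [])) ∷ []

  IdGplusGId : HatBasis × HatBasis → Lin (HatBasis × HatBasis)
  IdGplusGId (a , b) = mapB (λ b′ → (a , b′)) (GH b) ++ mapB (λ a′ → (a′ , b)) (GH a)

  Δ̂ : Lin HatBasis → Lin (HatBasis × HatBasis)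
  Δ̂ = ext ΔH

  Ĝ : Lin HatBasis → Lin HatBasis
  Ĝ = ext GH

  IdG+GId : Lin (HatBasis × HatBasis) → Lin (HatBasis × HatBasis)
  IdG+GId = ext IdGplusGId

  _≈⊗_ : Lin (HatBasis × HatBasis) → Lin (HatBasis × HatBasis) → Set ℓ
  x ≈⊗ y = ∀ t → coeff _≟HH_ x t ≈ coeff _≟HH_ y t

-- Over the free algebra F, both Δ∘G and (id⊗G + G⊗id)∘Δ obey the Leibniz rule
-- up to the same cross terms G(u)Δ(v) + Δ(u)G(v), so their difference is a
-- derivation F → F⊗F for the bimodule structure u(a⊗b)v = ua⊗bv. So is
-- w ↦ Δ(w)(𝐜⊗1) + 1⊗w − w⊗1, the last two terms forming the inner derivation
-- of 1⊗1. A derivation is determined by its values on the generators, and on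
-- 𝐜 and 𝐝 the two agree by direct computation; hence for every word w
--   Δ(G w) + w⊗1 = (id⊗G + G⊗id)(Δ w) + Δ(w)(𝐜⊗1) + 1⊗w.
-- Expanding Δ̂(Ĝ w) and (id⊗Ĝ + Ĝ⊗id)(Δ̂ w) with Δ(w𝐜) = Δ(w)(1⊗𝐜) + 2 w⊗1,
-- the terms involving e, Δ(w)(1⊗𝐜) and w𝐜 match up and what remains is that
-- identity. On e both sides are e⊗1 + 1⊗e, and both sides are linear.

{-# OPTIONS --safe #-}
module Submission where

open import Defs
open import Algebra.Bundles using (CommutativeRing; CommutativeMonoid)
open import Data.Bool using (true; false)
open import Data.List using ([]; _∷_; _++_; [_]; map; concatMap)
import Data.List.Properties as List
open import Data.Maybe using (nothing; just)
open import Data.Product using (_×_; _,_)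
open import Function using (_∘_; flip)
open import Level using (_⊔_)
open import Relation.Binary.Bundles using (Setoid)
open import Relation.Binary.Definitions using (DecidableEquality)
open import Relation.Binary.PropositionalEquality as ≡ using (_≡_)
open import Relation.Nullary using (does)
import Algebra.Solver.CommutativeMonoid as CommutativeMonoidSolver
import Relation.Binary.Reasoning.Setoid as SetoidReasoning

module _ {c ℓ} (K : CommutativeRing c ℓ) where
  open CommutativeRing K
  open FreeAlg K

  -- Formal sums up to reordering and collecting like terms. This is finer than
  -- equality of coefficients (≋⇒coeff≈) but, unlike it, is respected by every
  -- map on basis elements, so all computations are done with _≋_.
  infix 4 _≋_
  data _≋_ {B : Set} : Lin B → Lin B → Set (c ⊔ ℓ) where
    ≋-refl  : ∀ {p} → p ≋ p
    ≋-sym   : ∀ {p q} → p ≋ q → q ≋ p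
    ≋-trans : ∀ {p q r} → p ≋ q → q ≋ r → p ≋ r
    ++⁺     : ∀ {p p′ q q′} → p ≋ p′ → q ≋ q′ → p ++ q ≋ p′ ++ q′
    ++-comm : ∀ p q → p ++ q ≋ q ++ p
    merge   : ∀ r s a → (r , a) ∷ (s , a) ∷ [] ≋ [ (r + s , a) ]
    drop-zero  : ∀ a → [ (0# , a) ] ≋ []
    coefficient-cong   : ∀ {r s} a → r ≈ s → [ (r , a) ] ≋ [ (s , a) ]

  ≡⇒≋ : ∀ {B} {p q : Lin B} → p ≡ q → p ≋ q
  ≡⇒≋ ≡.refl = ≋-refl

  ≋-setoid : Set → Setoid c (c ⊔ ℓ)
  ≋-setoid B = record
    { Carrier = Lin B ; _≈_ = _≋_
    ; isEquivalence = record { refl = ≋-refl ; sym = ≋-sym ; trans = ≋-trans } }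

  ++-commutativeMonoid : Set → CommutativeMonoid c (c ⊔ ℓ)
  ++-commutativeMonoid B = record
    { Carrier = Lin B ; _≈_ = _≋_ ; _∙_ = _++_ ; ε = []
    ; isCommutativeMonoid = record
      { isMonoid = record
        { isSemigroup = record
          { isMagma = record
            { isEquivalence = Setoid.isEquivalence (≋-setoid B) ; ∙-cong = ++⁺ }
          ; assoc = λ p q r → ≡⇒≋ (List.++-assoc p q r) }
        ; identity = (λ _ → ≋-refl) , (λ p → ≡⇒≋ (List.++-identityʳ p)) }
      ; comm = ++-comm } }

  module ≋-Reasoning {B : Set} = SetoidReasoning (≋-setoid B)
  module ++-Solver {B : Set} = CommutativeMonoidSolver (++-commutativeMonoid B)

  module _ {B : Set} (_≟_ : DecidableEquality B) where
    private
      coeff-++ : ∀ p q b → coeff _≟_ (p ++ q) b ≈ coeff _≟_ p b + coeff _≟_ q b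
      coeff-++ [] q b = sym (+-identityˡ _)
      coeff-++ ((r , a) ∷ p) q b = trans (+-congˡ (coeff-++ p q b)) (sym (+-assoc _ _ _))

    ≋⇒coeff≈ : ∀ {p q : Lin B} → p ≋ q → ∀ b → coeff _≟_ p b ≈ coeff _≟_ q b
    ≋⇒coeff≈ ≋-refl b = refl
    ≋⇒coeff≈ (≋-sym p≋q) b = sym (≋⇒coeff≈ p≋q b)
    ≋⇒coeff≈ (≋-trans p≋q q≋r) b = trans (≋⇒coeff≈ p≋q b) (≋⇒coeff≈ q≋r b)
    ≋⇒coeff≈ (++⁺ {p} {p′} {q} {q′} p≋p′ q≋q′) b = begin
      coeff _≟_ (p ++ q) b               ≈⟨ coeff-++ p q b ⟩
      coeff _≟_ p b + coeff _≟_ q b      ≈⟨ +-cong (≋⇒coeff≈ p≋p′ b) (≋⇒coeff≈ q≋q′ b) ⟩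
      coeff _≟_ p′ b + coeff _≟_ q′ b    ≈⟨ coeff-++ p′ q′ b ⟨
      coeff _≟_ (p′ ++ q′) b             ∎
      where open SetoidReasoning setoid
    ≋⇒coeff≈ (++-comm p q) b =
      trans (coeff-++ p q b) (trans (+-comm _ _) (sym (coeff-++ q p b)))
    ≋⇒coeff≈ (merge r s a) b with does (a ≟ b)
    ... | true  = sym (+-assoc r s 0#)
    ... | false = +-congˡ (+-identityʳ 0#)
    ≋⇒coeff≈ (drop-zero a) b with does (a ≟ b)
    ... | true  = +-identityʳ 0#
    ... | false = +-identityʳ 0#
    ≋⇒coeff≈ (coefficient-cong a r≈s) b with does (a ≟ b)
    ... | true  = +-congʳ r≈s
    ... | false = refl

  module _ {A B : Set} (F : Lin A → Lin B)
    (F-++ : ∀ p q → F (p ++ q) ≡ F p ++ F q)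
    (F-merge : ∀ r s a → F ((r , a) ∷ (s , a) ∷ []) ≋ F [ (r + s , a) ])
    (F-drop-zero : ∀ a → F [ (0# , a) ] ≋ F [])
    (F-coefficient-cong : ∀ {r s} a → r ≈ s → F [ (r , a) ] ≋ F [ (s , a) ]) where

    ++-homomorphism-cong : ∀ {p q} → p ≋ q → F p ≋ F q
    ++-homomorphism-cong ≋-refl = ≋-refl
    ++-homomorphism-cong (≋-sym p≋q) = ≋-sym (++-homomorphism-cong p≋q)
    ++-homomorphism-cong (≋-trans p≋q q≋r) =
      ≋-trans (++-homomorphism-cong p≋q) (++-homomorphism-cong q≋r)
    ++-homomorphism-cong (++⁺ {p} {p′} {q} {q′} p≋p′ q≋q′) = begin
      F (p ++ q)     ≡⟨ F-++ p q ⟩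
      F p ++ F q     ≈⟨ ++⁺ (++-homomorphism-cong p≋p′) (++-homomorphism-cong q≋q′) ⟩
      F p′ ++ F q′   ≡⟨ F-++ p′ q′ ⟨
      F (p′ ++ q′)   ∎
      where open ≋-Reasoning
    ++-homomorphism-cong (++-comm p q) = begin
      F (p ++ q)     ≡⟨ F-++ p q ⟩
      F p ++ F q     ≈⟨ ++-comm (F p) (F q) ⟩
      F q ++ F p     ≡⟨ F-++ q p ⟨
      F (q ++ p)     ∎
      where open ≋-Reasoning
    ++-homomorphism-cong (merge r s a) = F-merge r s a
    ++-homomorphism-cong (drop-zero a) = F-drop-zero a
    ++-homomorphism-cong (coefficient-cong a r≈s) = F-coefficient-cong a r≈s

  mapB-++ : ∀ {A B} (f : A → B) p q → mapB f (p ++ q) ≡ mapB f p ++ mapB f q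
  mapB-++ f = List.map-++ _

  mapB-∘ : ∀ {A B C} (g : B → C) (f : A → B) p → mapB g (mapB f p) ≡ mapB (g ∘ f) p
  mapB-∘ g f p = ≡.sym (List.map-∘ p)

  mapB-cong : ∀ {A B} (f : A → B) {p q} → p ≋ q → mapB f p ≋ mapB f q
  mapB-cong f = ++-homomorphism-cong (mapB f) (mapB-++ f)
    (λ r s a → merge r s (f a)) (λ a → drop-zero (f a)) (λ a → coefficient-cong (f a))

  mapB-congˡ : ∀ {A B} {f g : A → B} → (∀ a → f a ≡ g a) → ∀ p → mapB f p ≡ mapB g p
  mapB-congˡ f≗g = List.map-cong λ { (r , a) → ≡.cong (r ,_) (f≗g a) }

  mapB-mapB : ∀ {A B B′ C} {f : B → C} {g : A → B} {h : B′ → C} {k : A → B′} →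
    (∀ a → f (g a) ≡ h (k a)) → ∀ p → mapB f (mapB g p) ≡ mapB h (mapB k p)
  mapB-mapB fg≗hk p = ≡.trans (mapB-∘ _ _ p) (≡.trans (mapB-congˡ fg≗hk p) (≡.sym (mapB-∘ _ _ p)))

  scale-++ : ∀ {B} r (p q : Lin B) → scale r (p ++ q) ≡ scale r p ++ scale r q
  scale-++ r = List.map-++ _

  scale-mapB : ∀ {A B} r (f : A → B) p → scale r (mapB f p) ≡ mapB f (scale r p)
  scale-mapB r f p = ≡.trans (≡.sym (List.map-∘ p)) (List.map-∘ p)

  scale-congʳ : ∀ {B} r {p q : Lin B} → p ≋ q → scale r p ≋ scale r q
  scale-congʳ r = ++-homomorphism-cong (scale r) (scale-++ r)
    (λ s t a → ≋-trans (merge _ _ a) (coefficient-cong a (sym (distribˡ r s t))))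
    (λ a → ≋-trans (coefficient-cong a (zeroʳ r)) (drop-zero a))
    (λ a s≈t → coefficient-cong a (*-congˡ s≈t))

  scale-congˡ : ∀ {B} {r s} (p : Lin B) → r ≈ s → scale r p ≋ scale s p
  scale-congˡ [] r≈s = ≋-refl
  scale-congˡ ((t , a) ∷ p) r≈s = ++⁺ (coefficient-cong a (*-congʳ r≈s)) (scale-congˡ p r≈s)

  scale-1 : ∀ {B} (p : Lin B) → scale 1# p ≋ p
  scale-1 [] = ≋-refl
  scale-1 ((t , a) ∷ p) = ++⁺ (coefficient-cong a (*-identityˡ t)) (scale-1 p)

  scale-0 : ∀ {B} (p : Lin B) → scale 0# p ≋ []
  scale-0 [] = ≋-refl
  scale-0 ((t , a) ∷ p) = ++⁺ (≋-trans (coefficient-cong a (zeroˡ t)) (drop-zero a)) (scale-0 p)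

  scale-+ : ∀ {B} r s (p : Lin B) → scale r p ++ scale s p ≋ scale (r + s) p
  scale-+ r s [] = ≋-refl
  scale-+ r s ((t , a) ∷ p) = begin
    (r * t , a) ∷ scale r p ++ (s * t , a) ∷ scale s p
      ≈⟨ solve 4 (λ x p y q → x ⊕ (p ⊕ (y ⊕ q)) ⊜ (x ⊕ y) ⊕ (p ⊕ q)) ≋-refl
           [ (r * t , a) ] (scale r p) [ (s * t , a) ] (scale s p) ⟩
    ((r * t , a) ∷ (s * t , a) ∷ []) ++ (scale r p ++ scale s p)
      ≈⟨ ++⁺ (≋-trans (merge _ _ a) (coefficient-cong a (sym (distribʳ t r s)))) (scale-+ r s p) ⟩
    ((r + s) * t , a) ∷ scale (r + s) p
      ∎
    where
    open ≋-Reasoning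
    open ++-Solver

  scale-scale : ∀ {B} r s (p : Lin B) → scale r (scale s p) ≋ scale (r * s) p
  scale-scale r s [] = ≋-refl
  scale-scale r s ((t , a) ∷ p) = ++⁺ (coefficient-cong a (sym (*-assoc r s t))) (scale-scale r s p)

  ext-++ : ∀ {A B} (f : A → Lin B) p q → ext f (p ++ q) ≡ ext f p ++ ext f q
  ext-++ f = List.concatMap-++ _

  ext-cong : ∀ {A B} (f : A → Lin B) {p q} → p ≋ q → ext f p ≋ ext f q
  ext-cong f = ++-homomorphism-cong (ext f) (ext-++ f)
    (λ r s a → ≋-trans (++⁺ (≋-refl {p = scale r (f a)}) (≡⇒≋ (List.++-identityʳ _)))
                      (≋-trans (scale-+ r s (f a)) (≡⇒≋ (≡.sym (List.++-identityʳ _)))))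
    (λ a → ≋-trans (≡⇒≋ (List.++-identityʳ _)) (scale-0 (f a)))
    (λ a r≈s → ++⁺ (scale-congˡ (f a) r≈s) ≋-refl)

  ext-congˡ : ∀ {A B} {f g : A → Lin B} → (∀ a → f a ≋ g a) → ∀ p → ext f p ≋ ext g p
  ext-congˡ f≋g [] = ≋-refl
  ext-congˡ f≋g ((r , a) ∷ p) = ++⁺ (scale-congʳ r (f≋g a)) (ext-congˡ f≋g p)

  ext-unit-coefficients : ∀ {A B} (f : A → Lin B) as → ext f (map (1# ,_) as) ≋ concatMap f as
  ext-unit-coefficients f [] = ≋-refl
  ext-unit-coefficients f (a ∷ as) = ++⁺ (scale-1 (f a)) (ext-unit-coefficients f as)

  ext-mapB : ∀ {A B C} (f : B → Lin C) (h : A → B) p → ext f (mapB h p) ≡ ext (f ∘ h) p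
  ext-mapB f h [] = ≡.refl
  ext-mapB f h ((r , a) ∷ p) = ≡.cong (scale r (f (h a)) ++_) (ext-mapB f h p)

  mapB-ext : ∀ {A B C} (h : B → C) (f : A → Lin B) p → mapB h (ext f p) ≡ ext (mapB h ∘ f) p
  mapB-ext h f [] = ≡.refl
  mapB-ext h f ((r , a) ∷ p) = ≡.trans (mapB-++ h (scale r (f a)) (ext f p))
    (≡.cong₂ _++_ (≡.sym (scale-mapB r h (f a))) (mapB-ext h f p))

  ext-scale : ∀ {A B} (f : A → Lin B) r p → ext f (scale r p) ≋ scale r (ext f p)
  ext-scale f r [] = ≋-refl
  ext-scale f r ((t , a) ∷ p) =
    ≋-trans (++⁺ (≋-sym (scale-scale r t (f a))) (ext-scale f r p))
            (≡⇒≋ (≡.sym (scale-++ r (scale t (f a)) (ext f p))))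

  ext-ext : ∀ {A B C} (f : B → Lin C) (g : A → Lin B) p → ext f (ext g p) ≋ ext (ext f ∘ g) p
  ext-ext f g [] = ≋-refl
  ext-ext f g ((r , a) ∷ p) =
    ≋-trans (≡⇒≋ (ext-++ f (scale r (g a)) (ext g p))) (++⁺ (ext-scale f r (g a)) (ext-ext f g p))

  ext-++ᶠ : ∀ {A B} (f g : A → Lin B) p → ext (λ a → f a ++ g a) p ≋ ext f p ++ ext g p
  ext-++ᶠ f g [] = ≋-refl
  ext-++ᶠ f g ((r , a) ∷ p) = begin
    scale r (f a ++ g a) ++ ext (λ a → f a ++ g a) p
      ≈⟨ ++⁺ (≡⇒≋ (scale-++ r (f a) (g a))) (ext-++ᶠ f g p) ⟩
    (scale r (f a) ++ scale r (g a)) ++ (ext f p ++ ext g p)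
      ≈⟨ solve 4 (λ x y p q → (x ⊕ y) ⊕ (p ⊕ q) ⊜ (x ⊕ p) ⊕ (y ⊕ q)) ≋-refl
           (scale r (f a)) (scale r (g a)) (ext f p) (ext g p) ⟩
    (scale r (f a) ++ ext f p) ++ (scale r (g a) ++ ext g p)
      ∎
    where
    open ≋-Reasoning
    open ++-Solver

  ext-singleton : ∀ {A B} s (h : A → B) p → ext (λ a → [ (s , h a) ]) p ≋ scale s (mapB h p)
  ext-singleton s h [] = ≋-refl
  ext-singleton s h ((r , a) ∷ p) = ++⁺ (coefficient-cong (h a) (*-comm r s)) (ext-singleton s h p)

  ext-mapB-≋ : ∀ {A B} (f : A → Lin B) (h : A → A) (k : B → B) (g : A → Lin B) →
    (∀ a → f (h a) ≋ mapB k (f a) ++ g a) → ∀ p → ext f (mapB h p) ≋ mapB k (ext f p) ++ ext g p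
  ext-mapB-≋ f h k g f∘h≋ p = begin
    ext f (mapB h p)                  ≡⟨ ext-mapB f h p ⟩
    ext (f ∘ h) p                     ≈⟨ ext-congˡ f∘h≋ p ⟩
    ext (λ a → mapB k (f a) ++ g a) p ≈⟨ ext-++ᶠ (mapB k ∘ f) g p ⟩
    ext (mapB k ∘ f) p ++ ext g p     ≡⟨ ≡.cong (_++ ext g p) (mapB-ext k f p) ⟨
    mapB k (ext f p) ++ ext g p       ∎
    where open ≋-Reasoning

  ext-unit-singleton : ∀ {A B} (h : A → B) p → ext (λ a → [ (1# , h a) ]) p ≋ mapB h p
  ext-unit-singleton h p = ≋-trans (ext-singleton 1# h p) (scale-1 (mapB h p))

  lift₂ : ∀ {A B C} → (A → B → C) → Lin A → Lin B → Lin C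
  lift₂ f p q = ext (λ a → mapB (f a) q) p

  lift₂-flip : ∀ {A B C} (f : A → B → C) p q → lift₂ f p q ≋ lift₂ (flip f) q p
  lift₂-flip f [] q = ≡⇒≋ (≡.sym (ext-[] q))
    where
    ext-[] : ∀ q → ext (λ b → []) q ≡ []
    ext-[] [] = ≡.refl
    ext-[] (_ ∷ q) = ext-[] q
  lift₂-flip f ((r , a) ∷ p) q = begin
    scale r (mapB (f a) q) ++ lift₂ f p q
      ≈⟨ ++⁺ (≋-sym (ext-singleton r (f a) q)) (lift₂-flip f p q) ⟩
    ext (λ b → [ (r , f a b) ]) q ++ lift₂ (flip f) q p
      ≈⟨ ext-++ᶠ (λ b → [ (r , f a b) ]) (λ b → mapB (flip f b) p) q ⟨
    lift₂ (flip f) q ((r , a) ∷ p)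
      ∎
    where open ≋-Reasoning

  neg : ∀ {B} → Lin B → Lin B
  neg = scale (- 1#)

  infixl 6 _⊖_
  _⊖_ : ∀ {B} → Lin B → Lin B → Lin B
  p ⊖ q = p ++ neg q

  p⊖p≋[] : ∀ {B} (p : Lin B) → p ⊖ p ≋ []
  p⊖p≋[] p = begin
    p ++ neg p                 ≈⟨ ++⁺ (scale-1 p) ≋-refl ⟨
    scale 1# p ++ neg p        ≈⟨ scale-+ 1# (- 1#) p ⟩
    scale (1# + - 1#) p        ≈⟨ scale-congˡ p (-‿inverseʳ 1#) ⟩
    scale 0# p                 ≈⟨ scale-0 p ⟩
    []                         ∎
    where open ≋-Reasoning

  ++-absorbs-⊖ : ∀ {B} (p q : Lin B) → p ++ (q ⊖ q) ≋ p
  ++-absorbs-⊖ p q = ≋-trans (++⁺ (≋-refl {p = p}) (p⊖p≋[] q)) (≡⇒≋ (List.++-identityʳ p))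

  ++-≋⇒⊖-≋ : ∀ {B} {a b c d : Lin B} → a ++ d ≋ b ++ c → a ⊖ b ≋ c ⊖ d
  ++-≋⇒⊖-≋ {a = a} {b} {c} {d} a+d≋b+c = begin
    a ⊖ b                          ≈⟨ ++-absorbs-⊖ (a ⊖ b) d ⟨
    (a ++ neg b) ++ (d ++ neg d)   ≈⟨ solve 4 (λ a b′ d d′ → (a ⊕ b′) ⊕ (d ⊕ d′) ⊜ (a ⊕ d) ⊕ (b′ ⊕ d′))
                                        ≋-refl a (neg b) d (neg d) ⟩
    (a ++ d) ++ (neg b ++ neg d)   ≈⟨ ++⁺ a+d≋b+c ≋-refl ⟩
    (b ++ c) ++ (neg b ++ neg d)   ≈⟨ solve 4 (λ b c b′ d′ → (b ⊕ c) ⊕ (b′ ⊕ d′) ⊜ (c ⊕ d′) ⊕ (b ⊕ b′))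
                                        ≋-refl b c (neg b) (neg d) ⟩
    (c ++ neg d) ++ (b ++ neg b)   ≈⟨ ++-absorbs-⊖ (c ⊖ d) b ⟩
    c ⊖ d                          ∎
    where
    open ≋-Reasoning
    open ++-Solver

  ⊖-≋⇒++-≋ : ∀ {B} {a b c d : Lin B} → a ⊖ b ≋ c ⊖ d → a ++ d ≋ b ++ c
  ⊖-≋⇒++-≋ {a = a} {b} {c} {d} a-b≋c-d = begin
    a ++ d                         ≈⟨ ++-absorbs-⊖ (a ++ d) b ⟨
    (a ++ d) ++ (b ++ neg b)       ≈⟨ solve 4 (λ a d b b′ → (a ⊕ d) ⊕ (b ⊕ b′) ⊜ (a ⊕ b′) ⊕ (b ⊕ d))
                                        ≋-refl a d b (neg b) ⟩
    (a ++ neg b) ++ (b ++ d)       ≈⟨ ++⁺ a-b≋c-d ≋-refl ⟩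
    (c ++ neg d) ++ (b ++ d)       ≈⟨ solve 4 (λ c d′ b d → (c ⊕ d′) ⊕ (b ⊕ d) ⊜ (b ⊕ c) ⊕ (d ⊕ d′))
                                        ≋-refl c (neg d) b d ⟩
    (b ++ c) ++ (d ++ neg d)       ≈⟨ ++-absorbs-⊖ (b ++ c) d ⟩
    b ++ c                         ∎
    where
    open ≋-Reasoning
    open ++-Solver

  mapB-⊖ : ∀ {A B} (f : A → B) p q → mapB f (p ⊖ q) ≡ mapB f p ⊖ mapB f q
  mapB-⊖ f p q = ≡.trans (mapB-++ f p (neg q)) (≡.cong (mapB f p ++_) (≡.sym (scale-mapB (- 1#) f q)))

  module Derivation {M : Set} (_◃_ : Word → M → M) (_▹_ : M → Word → M)
    (◃-identity : ∀ m → [] ◃ m ≡ m)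
    (◃-assoc : ∀ u u′ m → (u ++ u′) ◃ m ≡ u ◃ (u′ ◃ m))
    (▹-assoc : ∀ m v v′ → m ▹ (v ++ v′) ≡ (m ▹ v) ▹ v′)
    (◃▹-assoc : ∀ u m v → (u ◃ m) ▹ v ≡ u ◃ (m ▹ v)) where

    IsDerivation : (Word → Lin M) → Set (c ⊔ ℓ)
    IsDerivation D = ∀ u v → D (u ++ v) ≋ mapB (_▹ v) (D u) ++ mapB (u ◃_) (D v)

    IsDerivationUpTo : (Word → Word → Lin M) → (Word → Lin M) → Set (c ⊔ ℓ)
    IsDerivationUpTo C D = ∀ u v → D (u ++ v) ≋ (mapB (_▹ v) (D u) ++ mapB (u ◃_) (D v)) ++ C u v

    leibniz-isDerivation : (D : Word → Lin M) (D₁ : Letter → Lin M) → D [] ≡ [] →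
      (∀ x w → D (x ∷ w) ≡ mapB (_▹ w) (D₁ x) ++ mapB ([ x ] ◃_) (D w)) → IsDerivation D
    leibniz-isDerivation D D₁ D[]≡[] D-∷ [] v = begin
      D v                                   ≡⟨ List.map-id (D v) ⟨
      mapB (λ m → m) (D v)                  ≡⟨ mapB-congˡ (λ m → ≡.sym (◃-identity m)) (D v) ⟩
      mapB ([] ◃_) (D v)                    ≡⟨ ≡.cong (λ p → mapB (_▹ v) p ++ mapB ([] ◃_) (D v)) D[]≡[] ⟨
      mapB (_▹ v) (D []) ++ mapB ([] ◃_) (D v) ∎
      where open ≋-Reasoning
    leibniz-isDerivation D D₁ D[]≡[] D-∷ (x ∷ u) v = begin
      D (x ∷ u ++ v)
        ≡⟨ D-∷ x (u ++ v) ⟩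
      mapB (_▹ (u ++ v)) (D₁ x) ++ mapB ([ x ] ◃_) (D (u ++ v))
        ≈⟨ ++⁺ ≋-refl (mapB-cong ([ x ] ◃_) (leibniz-isDerivation D D₁ D[]≡[] D-∷ u v)) ⟩
      mapB (_▹ (u ++ v)) (D₁ x) ++ mapB ([ x ] ◃_) (mapB (_▹ v) (D u) ++ mapB (u ◃_) (D v))
        ≡⟨ ≡.cong (mapB (_▹ (u ++ v)) (D₁ x) ++_) (mapB-++ ([ x ] ◃_) (mapB (_▹ v) (D u)) _) ⟩
      A ++ (B ++ C)
        ≡⟨ List.++-assoc A B C ⟨
      (A ++ B) ++ C
        ≡⟨ ≡.cong₂ _++_ (≡.cong₂ _++_ A≡ B≡) C≡ ⟩
      (mapB (_▹ v) (mapB (_▹ u) (D₁ x)) ++ mapB (_▹ v) (mapB ([ x ] ◃_) (D u))) ++ mapB ((x ∷ u) ◃_) (D v)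
        ≡⟨ ≡.cong₂ _++_ (≡.trans (≡.sym (mapB-++ (_▹ v) (mapB (_▹ u) (D₁ x)) (mapB ([ x ] ◃_) (D u))))
                                          (≡.cong (mapB (_▹ v)) (≡.sym (D-∷ x u)))) ≡.refl ⟩
      mapB (_▹ v) (D (x ∷ u)) ++ mapB ((x ∷ u) ◃_) (D v)
        ∎
      where
      open ≋-Reasoning
      A = mapB (_▹ (u ++ v)) (D₁ x)
      B = mapB ([ x ] ◃_) (mapB (_▹ v) (D u))
      C = mapB ([ x ] ◃_) (mapB (u ◃_) (D v))
      A≡ : A ≡ mapB (_▹ v) (mapB (_▹ u) (D₁ x))
      A≡ = ≡.trans (mapB-congˡ (λ m → ▹-assoc m u v) (D₁ x)) (≡.sym (mapB-∘ _ _ (D₁ x)))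
      B≡ : B ≡ mapB (_▹ v) (mapB ([ x ] ◃_) (D u))
      B≡ = ≡.trans (mapB-∘ _ _ (D u))
             (≡.trans (mapB-congˡ (λ m → ≡.sym (◃▹-assoc [ x ] m v)) (D u)) (≡.sym (mapB-∘ _ _ (D u))))
      C≡ : C ≡ mapB ((x ∷ u) ◃_) (D v)
      C≡ = ≡.trans (mapB-∘ _ _ (D v)) (mapB-congˡ (λ m → ≡.sym (◃-assoc [ x ] u m)) (D v))

    mapB-isDerivation : ∀ {D} (f : M → M) →
      (∀ u m → f (u ◃ m) ≡ u ◃ f m) → (∀ m v → f (m ▹ v) ≡ f m ▹ v) →
      IsDerivation D → IsDerivation (mapB f ∘ D)
    mapB-isDerivation {D} f f-◃ f-▹ D-derivation u v = begin
      mapB f (D (u ++ v))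
        ≈⟨ mapB-cong f (D-derivation u v) ⟩
      mapB f (mapB (_▹ v) (D u) ++ mapB (u ◃_) (D v))
        ≡⟨ mapB-++ f (mapB (_▹ v) (D u)) (mapB (u ◃_) (D v)) ⟩
      mapB f (mapB (_▹ v) (D u)) ++ mapB f (mapB (u ◃_) (D v))
        ≡⟨ ≡.cong₂ _++_ (mapB-mapB (λ m → f-▹ m v) (D u)) (mapB-mapB (f-◃ u) (D v)) ⟩
      mapB (_▹ v) (mapB f (D u)) ++ mapB (u ◃_) (mapB f (D v))
        ∎
      where open ≋-Reasoning

    isDerivation-++ : ∀ {D D′} → IsDerivation D → IsDerivation D′ → IsDerivation (λ w → D w ++ D′ w)
    isDerivation-++ {D} {D′} D-derivation D′-derivation u v = begin
      D (u ++ v) ++ D′ (u ++ v)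
        ≈⟨ ++⁺ (D-derivation u v) (D′-derivation u v) ⟩
      (mapB (_▹ v) (D u) ++ mapB (u ◃_) (D v)) ++ (mapB (_▹ v) (D′ u) ++ mapB (u ◃_) (D′ v))
        ≈⟨ solve 4 (λ a b a′ b′ → (a ⊕ b) ⊕ (a′ ⊕ b′) ⊜ (a ⊕ a′) ⊕ (b ⊕ b′)) ≋-refl
             (mapB (_▹ v) (D u)) (mapB (u ◃_) (D v)) (mapB (_▹ v) (D′ u)) (mapB (u ◃_) (D′ v)) ⟩
      (mapB (_▹ v) (D u) ++ mapB (_▹ v) (D′ u)) ++ (mapB (u ◃_) (D v) ++ mapB (u ◃_) (D′ v))
        ≡⟨ ≡.cong₂ _++_ (mapB-++ (_▹ v) (D u) (D′ u)) (mapB-++ (u ◃_) (D v) (D′ v)) ⟨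
      mapB (_▹ v) (D u ++ D′ u) ++ mapB (u ◃_) (D v ++ D′ v)
        ∎
      where
      open ≋-Reasoning
      open ++-Solver

    isDerivation-⊖ : ∀ {C D D′} → IsDerivationUpTo C D → IsDerivationUpTo C D′ →
      IsDerivation (λ w → D w ⊖ D′ w)
    isDerivation-⊖ {C} {D} {D′} D-derivation D′-derivation u v = begin
      D (u ++ v) ++ neg (D′ (u ++ v))
        ≈⟨ ++⁺ (D-derivation u v) (scale-congʳ (- 1#) (D′-derivation u v)) ⟩
      ((a ++ b) ++ C u v) ++ neg ((a′ ++ b′) ++ C u v)
        ≡⟨ ≡.cong (((a ++ b) ++ C u v) ++_)
             (≡.trans (scale-++ (- 1#) (a′ ++ b′) (C u v)) (≡.cong (_++ neg (C u v)) (scale-++ (- 1#) a′ b′))) ⟩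
      ((a ++ b) ++ C u v) ++ ((neg a′ ++ neg b′) ++ neg (C u v))
        ≈⟨ solve 6 (λ a b c a′ b′ c′ →
               ((a ⊕ b) ⊕ c) ⊕ ((a′ ⊕ b′) ⊕ c′) ⊜ ((a ⊕ a′) ⊕ (b ⊕ b′)) ⊕ (c ⊕ c′))
             ≋-refl a b (C u v) (neg a′) (neg b′) (neg (C u v)) ⟩
      ((a ⊖ a′) ++ (b ⊖ b′)) ++ (C u v ⊖ C u v)
        ≈⟨ ++-absorbs-⊖ ((a ⊖ a′) ++ (b ⊖ b′)) (C u v) ⟩
      (a ⊖ a′) ++ (b ⊖ b′)
        ≡⟨ ≡.cong₂ _++_ (mapB-⊖ (_▹ v) (D u) (D′ u)) (mapB-⊖ (u ◃_) (D v) (D′ v)) ⟨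
      mapB (_▹ v) (D u ⊖ D′ u) ++ mapB (u ◃_) (D v ⊖ D′ v)
        ∎
      where
      open ≋-Reasoning
      open ++-Solver
      a = mapB (_▹ v) (D u)
      b = mapB (u ◃_) (D v)
      a′ = mapB (_▹ v) (D′ u)
      b′ = mapB (u ◃_) (D′ v)

    derivations-agree : ∀ {D D′} → IsDerivation D → IsDerivation D′ →
      D [] ≋ D′ [] → (∀ x → D [ x ] ≋ D′ [ x ]) → ∀ w → D w ≋ D′ w
    derivations-agree _ _ D[]≋D′[] _ [] = D[]≋D′[]
    derivations-agree {D} {D′} D-derivation D′-derivation D[]≋D′[] Dx≋D′x (x ∷ w) = begin
      D ([ x ] ++ w)
        ≈⟨ D-derivation [ x ] w ⟩
      mapB (_▹ w) (D [ x ]) ++ mapB ([ x ] ◃_) (D w)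
        ≈⟨ ++⁺ (mapB-cong (_▹ w) (Dx≋D′x x))
               (mapB-cong ([ x ] ◃_) (derivations-agree D-derivation D′-derivation D[]≋D′[] Dx≋D′x w)) ⟩
      mapB (_▹ w) (D′ [ x ]) ++ mapB ([ x ] ◃_) (D′ w)
        ≈⟨ D′-derivation [ x ] w ⟨
      D′ ([ x ] ++ w)
        ∎
      where open ≋-Reasoning

  _◃_ : Word → Word × Word → Word × Word
  u ◃ (a , b) = (u ++ a , b)

  _▹_ : Word × Word → Word → Word × Word
  (a , b) ▹ v = (a , b ++ v)

  infix 7 _⊗_
  _⊗_ : Word → Word → Lin (Word × Word)
  a ⊗ b = [ (1# , (a , b)) ]

  module F = Derivation _++_ _++_ (λ _ → ≡.refl) List.++-assoc
    (λ a v v′ → ≡.sym (List.++-assoc a v v′)) List.++-assoc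

  module F⊗F = Derivation _◃_ _▹_ (λ _ → ≡.refl)
    (λ u u′ (a , b) → ≡.cong (_, b) (List.++-assoc u u′ a))
    (λ (a , b) v v′ → ≡.cong (a ,_) (≡.sym (List.++-assoc b v v′)))
    (λ _ _ _ → ≡.refl)

  G-isDerivation : F.IsDerivation GW
  G-isDerivation = F.leibniz-isDerivation GW GL ≡.refl (λ _ _ → ≡.refl)

  Δ-isDerivation : F⊗F.IsDerivation ΔW
  Δ-isDerivation = F⊗F.leibniz-isDerivation ΔW ΔL ≡.refl (λ _ _ → ≡.refl)

  idG+Gid : Word × Word → Lin (Word × Word)
  idG+Gid (a , b) = mapB (a ,_) (GW b) ++ mapB (_, b) (GW a)

  Δ∘G : Word → Lin (Word × Word)
  Δ∘G w = ext ΔW (GW w)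

  idG+Gid∘Δ : Word → Lin (Word × Word)
  idG+Gid∘Δ w = ext idG+Gid (ΔW w)

  Δ-ext-++ʳ : ∀ U v → ext ΔW (mapB (_++ v) U) ≋ mapB (_▹ v) (ext ΔW U) ++ lift₂ _◃_ U (ΔW v)
  Δ-ext-++ʳ U v = ext-mapB-≋ ΔW (_++ v) (_▹ v) _ (λ a → Δ-isDerivation a v) U

  Δ-ext-++ˡ : ∀ u V → ext ΔW (mapB (u ++_) V) ≋ mapB (u ◃_) (ext ΔW V) ++ lift₂ _▹_ (ΔW u) V
  Δ-ext-++ˡ u V = ≋-trans
    (ext-mapB-≋ ΔW (u ++_) (u ◃_) _ (λ b → ≋-trans (Δ-isDerivation u b) (++-comm (mapB (_▹ b) (ΔW u)) _)) V)
    (++⁺ ≋-refl (lift₂-flip (flip _▹_) V (ΔW u)))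

  cross-terms : Word → Word → Lin (Word × Word)
  cross-terms u v = lift₂ _◃_ (GW u) (ΔW v) ++ lift₂ _▹_ (ΔW u) (GW v)

  Δ∘G-isDerivationUpTo : F⊗F.IsDerivationUpTo cross-terms Δ∘G
  Δ∘G-isDerivationUpTo u v = begin
    ext ΔW (GW (u ++ v))
      ≈⟨ ext-cong ΔW (G-isDerivation u v) ⟩
    ext ΔW (mapB (_++ v) (GW u) ++ mapB (u ++_) (GW v))
      ≡⟨ ext-++ ΔW (mapB (_++ v) (GW u)) (mapB (u ++_) (GW v)) ⟩
    ext ΔW (mapB (_++ v) (GW u)) ++ ext ΔW (mapB (u ++_) (GW v))
      ≈⟨ ++⁺ (Δ-ext-++ʳ (GW u) v) (Δ-ext-++ˡ u (GW v)) ⟩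
    (mapB (_▹ v) (Δ∘G u) ++ lift₂ _◃_ (GW u) (ΔW v)) ++ (mapB (u ◃_) (Δ∘G v) ++ lift₂ _▹_ (ΔW u) (GW v))
      ≈⟨ solve 4 (λ a c b c′ → (a ⊕ c) ⊕ (b ⊕ c′) ⊜ (a ⊕ b) ⊕ (c ⊕ c′)) ≋-refl
           (mapB (_▹ v) (Δ∘G u)) (lift₂ _◃_ (GW u) (ΔW v)) (mapB (u ◃_) (Δ∘G v)) (lift₂ _▹_ (ΔW u) (GW v)) ⟩
    (mapB (_▹ v) (Δ∘G u) ++ mapB (u ◃_) (Δ∘G v)) ++ cross-terms u v
      ∎
    where
    open ≋-Reasoning
    open ++-Solver

  idG+Gid-▹ : ∀ q v → idG+Gid (q ▹ v) ≋ mapB (_▹ v) (idG+Gid q) ++ mapB (q ▹_) (GW v)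
  idG+Gid-▹ (a , b) v = begin
    mapB (a ,_) (GW (b ++ v)) ++ mapB (_, b ++ v) (GW a)
      ≈⟨ ++⁺ (mapB-cong (a ,_) (G-isDerivation b v)) ≋-refl ⟩
    mapB (a ,_) (mapB (_++ v) (GW b) ++ mapB (b ++_) (GW v)) ++ mapB (_, b ++ v) (GW a)
      ≡⟨ ≡.cong₂ _++_
           (≡.trans (mapB-++ (a ,_) (mapB (_++ v) (GW b)) (mapB (b ++_) (GW v)))
                    (≡.cong₂ _++_ (mapB-mapB (λ _ → ≡.refl) (GW b)) (mapB-∘ _ _ (GW v))))
           (≡.sym (mapB-∘ _ _ (GW a))) ⟩
    (x ++ z) ++ y
      ≈⟨ solve 3 (λ x z y → (x ⊕ z) ⊕ y ⊜ (x ⊕ y) ⊕ z) ≋-refl x z y ⟩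
    (x ++ y) ++ z
      ≡⟨ ≡.cong (_++ z) (mapB-++ (_▹ v) (mapB (a ,_) (GW b)) (mapB (_, b) (GW a))) ⟨
    mapB (_▹ v) (idG+Gid (a , b)) ++ z
      ∎
    where
    open ≋-Reasoning
    open ++-Solver
    x = mapB (_▹ v) (mapB (a ,_) (GW b))
    y = mapB (_▹ v) (mapB (_, b) (GW a))
    z = mapB ((a , b) ▹_) (GW v)

  idG+Gid-◃ : ∀ u q → idG+Gid (u ◃ q) ≋ mapB (u ◃_) (idG+Gid q) ++ mapB (_◃ q) (GW u)
  idG+Gid-◃ u (a , b) = begin
    mapB (u ++ a ,_) (GW b) ++ mapB (_, b) (GW (u ++ a))
      ≈⟨ ++⁺ ≋-refl (mapB-cong (_, b) (G-isDerivation u a)) ⟩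
    mapB (u ++ a ,_) (GW b) ++ mapB (_, b) (mapB (_++ a) (GW u) ++ mapB (u ++_) (GW a))
      ≡⟨ ≡.cong₂ _++_ (≡.sym (mapB-∘ _ _ (GW b)))
           (≡.trans (mapB-++ (_, b) (mapB (_++ a) (GW u)) (mapB (u ++_) (GW a)))
                    (≡.cong₂ _++_ (mapB-∘ _ _ (GW u)) (mapB-mapB (λ _ → ≡.refl) (GW a)))) ⟩
    x ++ (z ++ y)
      ≈⟨ solve 3 (λ x z y → x ⊕ (z ⊕ y) ⊜ (x ⊕ y) ⊕ z) ≋-refl x z y ⟩
    (x ++ y) ++ z
      ≡⟨ ≡.cong (_++ z) (mapB-++ (u ◃_) (mapB (a ,_) (GW b)) (mapB (_, b) (GW a))) ⟨
    mapB (u ◃_) (idG+Gid (a , b)) ++ z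
      ∎
    where
    open ≋-Reasoning
    open ++-Solver
    x = mapB (u ◃_) (mapB (a ,_) (GW b))
    y = mapB (u ◃_) (mapB (_, b) (GW a))
    z = mapB (_◃ (a , b)) (GW u)

  idG+Gid∘Δ-isDerivationUpTo : F⊗F.IsDerivationUpTo cross-terms idG+Gid∘Δ
  idG+Gid∘Δ-isDerivationUpTo u v = begin
    ext idG+Gid (ΔW (u ++ v))
      ≈⟨ ext-cong idG+Gid (Δ-isDerivation u v) ⟩
    ext idG+Gid (mapB (_▹ v) (ΔW u) ++ mapB (u ◃_) (ΔW v))
      ≡⟨ ext-++ idG+Gid (mapB (_▹ v) (ΔW u)) (mapB (u ◃_) (ΔW v)) ⟩
    ext idG+Gid (mapB (_▹ v) (ΔW u)) ++ ext idG+Gid (mapB (u ◃_) (ΔW v))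
      ≈⟨ ++⁺ (ext-mapB-≋ idG+Gid (_▹ v) (_▹ v) _ (λ q → idG+Gid-▹ q v) (ΔW u))
             (ext-mapB-≋ idG+Gid (u ◃_) (u ◃_) _ (idG+Gid-◃ u) (ΔW v)) ⟩
    (a ++ lift₂ _▹_ (ΔW u) (GW v)) ++ (b ++ lift₂ (flip _◃_) (ΔW v) (GW u))
      ≈⟨ ++⁺ (≋-refl {p = a ++ lift₂ _▹_ (ΔW u) (GW v)})
             (++⁺ (≋-refl {p = b}) (lift₂-flip (flip _◃_) (ΔW v) (GW u))) ⟩
    (a ++ lift₂ _▹_ (ΔW u) (GW v)) ++ (b ++ lift₂ _◃_ (GW u) (ΔW v))
      ≈⟨ solve 4 (λ a c′ b c → (a ⊕ c′) ⊕ (b ⊕ c) ⊜ (a ⊕ b) ⊕ (c ⊕ c′)) ≋-refl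
           a (lift₂ _▹_ (ΔW u) (GW v)) b (lift₂ _◃_ (GW u) (ΔW v)) ⟩
    (a ++ b) ++ cross-terms u v
      ∎
    where
    open ≋-Reasoning
    open ++-Solver
    a = mapB (_▹ v) (idG+Gid∘Δ u)
    b = mapB (u ◃_) (idG+Gid∘Δ v)

  _·𝐜⊗1 : Word × Word → Word × Word
  (a , b) ·𝐜⊗1 = (a ++ [ 𝐜 ] , b)

  ad₁⊗₁ : Word → Lin (Word × Word)
  ad₁⊗₁ w = [] ⊗ w ⊖ w ⊗ []

  ad₁⊗₁-isDerivation : F⊗F.IsDerivation ad₁⊗₁
  ad₁⊗₁-isDerivation u v = begin
    [] ⊗ (u ++ v) ⊖ (u ++ v) ⊗ []
      ≈⟨ ++-absorbs-⊖ ([] ⊗ (u ++ v) ⊖ (u ++ v) ⊗ []) (u ⊗ v) ⟨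
    ([] ⊗ (u ++ v) ⊖ (u ++ v) ⊗ []) ++ (u ⊗ v ⊖ u ⊗ v)
      ≈⟨ solve 4 (λ x y z z′ → (x ⊕ y) ⊕ (z ⊕ z′) ⊜ (x ⊕ z′) ⊕ (z ⊕ y)) ≋-refl
           ([] ⊗ (u ++ v)) (neg ((u ++ v) ⊗ [])) (u ⊗ v) (neg (u ⊗ v)) ⟩
    ([] ⊗ (u ++ v) ⊖ u ⊗ v) ++ (u ⊗ v ⊖ (u ++ v) ⊗ [])
      ≡⟨ ≡.cong (λ u′ → ([] ⊗ (u ++ v) ⊖ u ⊗ v) ++ (u′ ⊗ v ⊖ (u ++ v) ⊗ [])) (List.++-identityʳ u) ⟨
    mapB (_▹ v) (ad₁⊗₁ u) ++ mapB (u ◃_) (ad₁⊗₁ v)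
      ∎
    where
    open ≋-Reasoning
    open ++-Solver

  ·𝐜⊗1-Δ-isDerivation : F⊗F.IsDerivation (mapB _·𝐜⊗1 ∘ ΔW)
  ·𝐜⊗1-Δ-isDerivation = F⊗F.mapB-isDerivation {ΔW} _·𝐜⊗1
    (λ u (a , b) → ≡.cong (_, b) (List.++-assoc u a [ 𝐜 ])) (λ _ _ → ≡.refl) Δ-isDerivation

  Δ∘G-on-letter : ∀ x →
    Δ∘G [ x ] ++ [ x ] ⊗ [] ≋ idG+Gid∘Δ [ x ] ++ (mapB _·𝐜⊗1 (ΔW [ x ]) ++ [] ⊗ [ x ])
  Δ∘G-on-letter 𝐜 = begin
    ext ΔW [ (1# , [ 𝐝 ]) ] ++ 𝐜⊗1
      ≈⟨ ++⁺ (ext-unit-coefficients ΔW [ [ 𝐝 ] ]) ≋-refl ⟩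
    ((1⊗𝐜 ++ 𝐜⊗1) ++ []) ++ 𝐜⊗1
      ≈⟨ solve 2 (λ a b → ((a ⊕ b) ⊕ id) ⊕ b ⊜ (b ⊕ b) ⊕ a) ≋-refl 1⊗𝐜 𝐜⊗1 ⟩
    (𝐜⊗1 ++ 𝐜⊗1) ++ 1⊗𝐜
      ≈⟨ ++⁺ (merge 1# 1# ([ 𝐜 ] , [])) ≋-refl ⟩
    [ (two , ([ 𝐜 ] , [])) ] ++ 1⊗𝐜
      ∎
    where
    open ≋-Reasoning
    open ++-Solver
    1⊗𝐜 = [] ⊗ [ 𝐜 ]
    𝐜⊗1 = [ 𝐜 ] ⊗ []
  Δ∘G-on-letter 𝐝 = begin
    ext ΔW [ (1# , 𝐜 ∷ 𝐝 ∷ []) ] ++ 𝐝⊗1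
      ≈⟨ ++⁺ (ext-unit-coefficients ΔW [ 𝐜 ∷ 𝐝 ∷ [] ]) ≋-refl ⟩
    (([ (two , ([] , [ 𝐝 ])) ] ++ 𝐜𝐜) ++ []) ++ 𝐝⊗1
      ≈⟨ solve 3 (λ a c d → ((a ⊕ c) ⊕ id) ⊕ d ⊜ a ⊕ (c ⊕ d)) ≋-refl
           [ (two , ([] , [ 𝐝 ])) ] 𝐜𝐜 𝐝⊗1 ⟩
    [ (two , ([] , [ 𝐝 ])) ] ++ (𝐜𝐜 ++ 𝐝⊗1)
      ≈⟨ ++⁺ (≋-sym (merge 1# 1# ([] , [ 𝐝 ]))) ≋-refl ⟩
    (1⊗𝐝 ++ 1⊗𝐝) ++ (𝐜𝐜 ++ 𝐝⊗1)
      ≈⟨ solve 3 (λ a c d → (a ⊕ a) ⊕ (c ⊕ d) ⊜ (a ⊕ (d ⊕ id)) ⊕ (c ⊕ a)) ≋-refl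
           1⊗𝐝 𝐜𝐜 𝐝⊗1 ⟩
    (1⊗𝐝 ++ (𝐝⊗1 ++ [])) ++ (𝐜𝐜 ++ 1⊗𝐝)
      ≈⟨ ++⁺ (ext-unit-coefficients idG+Gid (([] , [ 𝐜 ]) ∷ ([ 𝐜 ] , []) ∷ [])) ≋-refl ⟨
    idG+Gid∘Δ [ 𝐝 ] ++ (𝐜𝐜 ++ 1⊗𝐝)
      ∎
    where
    open ≋-Reasoning
    open ++-Solver
    1⊗𝐝 = [] ⊗ [ 𝐝 ]
    𝐝⊗1 = [ 𝐝 ] ⊗ []
    𝐜𝐜 = [ 𝐜 ] ⊗ [ 𝐜 ] ++ (𝐜 ∷ 𝐜 ∷ []) ⊗ []

  Δ∘G-on-words : ∀ w →
    Δ∘G w ++ w ⊗ [] ≋ idG+Gid∘Δ w ++ (mapB _·𝐜⊗1 (ΔW w) ++ [] ⊗ w)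
  Δ∘G-on-words w = ⊖-≋⇒++-≋ {a = Δ∘G w} {idG+Gid∘Δ w} {mapB _·𝐜⊗1 (ΔW w) ++ [] ⊗ w}
    (≋-trans (E≋H w) (≡⇒≋ (≡.sym (List.++-assoc (mapB _·𝐜⊗1 (ΔW w)) _ _))))
    where
    E H : Word → Lin (Word × Word)
    E w = Δ∘G w ⊖ idG+Gid∘Δ w
    H w = mapB _·𝐜⊗1 (ΔW w) ++ ad₁⊗₁ w
    E≋H : ∀ w → E w ≋ H w
    E≋H = F⊗F.derivations-agree {E} {H}
      (F⊗F.isDerivation-⊖ {cross-terms} {Δ∘G} {idG+Gid∘Δ} Δ∘G-isDerivationUpTo idG+Gid∘Δ-isDerivationUpTo)
      (F⊗F.isDerivation-++ {mapB _·𝐜⊗1 ∘ ΔW} {ad₁⊗₁} ·𝐜⊗1-Δ-isDerivation ad₁⊗₁-isDerivation)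
      (≋-sym (p⊖p≋[] ([] ⊗ [])))
      (λ x → ≋-trans (++-≋⇒⊖-≋ {a = Δ∘G [ x ]} {idG+Gid∘Δ [ x ]} {d = [ x ] ⊗ []} (Δ∘G-on-letter x))
                     (≡⇒≋ (List.++-assoc (mapB _·𝐜⊗1 (ΔW [ x ])) _ _)))

  Δ-++𝐜 : ∀ w → ΔW (w ++ [ 𝐜 ]) ≋ mapB (_▹ [ 𝐜 ]) (ΔW w) ++ [ (two , (w , [])) ]
  Δ-++𝐜 w = ≋-trans (Δ-isDerivation w [ 𝐜 ])
    (≡⇒≋ (≡.cong (λ w′ → mapB (_▹ [ 𝐜 ]) (ΔW w) ++ [ (two , (w′ , [])) ]) (List.++-identityʳ w)))

  just⊗just : Word × Word → HatBasis × HatBasis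
  just⊗just (a , b) = (just a , just b)

  𝐞 : HatBasis
  𝐞 = nothing

  infix 7 _⊗̂_
  _⊗̂_ : HatBasis → HatBasis → Lin (HatBasis × HatBasis)
  a ⊗̂ b = [ (1# , (a , b)) ]

  Δ̂-on-F : ∀ p → ext ΔH (mapB just p) ≋
    mapB just⊗just (ext ΔW p) ++ (mapB (𝐞 ,_) (mapB just p) ++ mapB (_, 𝐞) (mapB just p))
  Δ̂-on-F p = begin
    ext ΔH (mapB just p)
      ≡⟨ ext-mapB ΔH just p ⟩
    ext (λ u → mapB just⊗just (ΔW u) ++ (𝐞 ⊗̂ just u ++ just u ⊗̂ 𝐞)) p
      ≈⟨ ext-++ᶠ (mapB just⊗just ∘ ΔW) (λ u → 𝐞 ⊗̂ just u ++ just u ⊗̂ 𝐞) p ⟩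
    ext (mapB just⊗just ∘ ΔW) p ++ ext (λ u → 𝐞 ⊗̂ just u ++ just u ⊗̂ 𝐞) p
      ≈⟨ ++⁺ (≡⇒≋ (≡.sym (mapB-ext just⊗just ΔW p)))
             (≋-trans (ext-++ᶠ (λ u → 𝐞 ⊗̂ just u) (λ u → just u ⊗̂ 𝐞) p)
                      (++⁺ (ext-unit-singleton (λ u → (𝐞 , just u)) p)
                           (ext-unit-singleton (λ u → (just u , 𝐞)) p))) ⟩
    mapB just⊗just (ext ΔW p) ++ (mapB (λ u → (𝐞 , just u)) p ++ mapB (λ u → (just u , 𝐞)) p)
      ≡⟨ ≡.cong (mapB just⊗just (ext ΔW p) ++_) (≡.cong₂ _++_ (mapB-∘ _ _ p) (mapB-∘ _ _ p)) ⟨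
    mapB just⊗just (ext ΔW p) ++ (mapB (𝐞 ,_) (mapB just p) ++ mapB (_, 𝐞) (mapB just p))
      ∎
    where open ≋-Reasoning

  Δ̂-just-++𝐜 : ∀ w → ΔH (just (w ++ [ 𝐜 ])) ≋
    (mapB just⊗just (mapB (_▹ [ 𝐜 ]) (ΔW w)) ++ (just w ⊗̂ just [] ++ just w ⊗̂ just []))
      ++ (𝐞 ⊗̂ just (w ++ [ 𝐜 ]) ++ just (w ++ [ 𝐜 ]) ⊗̂ 𝐞)
  Δ̂-just-++𝐜 w = begin
    mapB just⊗just (ΔW (w ++ [ 𝐜 ])) ++ e-terms
      ≈⟨ ++⁺ (mapB-cong just⊗just (Δ-++𝐜 w)) ≋-refl ⟩
    mapB just⊗just (Δw·1⊗𝐜 ++ [ (two , (w , [])) ]) ++ e-terms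
      ≡⟨ ≡.cong (_++ e-terms) (mapB-++ just⊗just Δw·1⊗𝐜 [ (two , (w , [])) ]) ⟩
    (mapB just⊗just Δw·1⊗𝐜 ++ [ (two , (just w , just [])) ]) ++ e-terms
      ≈⟨ ++⁺ (++⁺ (≋-refl {p = mapB just⊗just Δw·1⊗𝐜}) (≋-sym (merge 1# 1# (just w , just []))))
             (≋-refl {p = e-terms}) ⟩
    (mapB just⊗just Δw·1⊗𝐜 ++ (just w ⊗̂ just [] ++ just w ⊗̂ just [])) ++ e-terms
      ∎
    where
    open ≋-Reasoning
    Δw·1⊗𝐜 = mapB (_▹ [ 𝐜 ]) (ΔW w)
    e-terms = 𝐞 ⊗̂ just (w ++ [ 𝐜 ]) ++ just (w ++ [ 𝐜 ]) ⊗̂ 𝐞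

  IdG+GId-just⊗just : ∀ t → IdGplusGId (just⊗just t) ≋
    mapB just⊗just (idG+Gid t) ++ ([ (1# , just⊗just (t ▹ [ 𝐜 ])) ] ++ [ (1# , just⊗just (t ·𝐜⊗1)) ])
  IdG+GId-just⊗just (a , b) = begin
    mapB (just a ,_) (mapB just (GW b) ++ [ r ]) ++ mapB (_, just b) (mapB just (GW a) ++ [ l ])
      ≡⟨ ≡.cong₂ _++_
           (≡.trans (mapB-++ (just a ,_) (mapB just (GW b)) [ r ])
                    (≡.cong (_++ r′) (mapB-mapB (λ _ → ≡.refl) (GW b))))
           (≡.trans (mapB-++ (_, just b) (mapB just (GW a)) [ l ])
                    (≡.cong (_++ l′) (mapB-mapB (λ _ → ≡.refl) (GW a)))) ⟩
    (x ++ r′) ++ (y ++ l′)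
      ≈⟨ solve 4 (λ x r y l → (x ⊕ r) ⊕ (y ⊕ l) ⊜ (x ⊕ y) ⊕ (r ⊕ l)) ≋-refl x r′ y l′ ⟩
    (x ++ y) ++ (r′ ++ l′)
      ≡⟨ ≡.cong (_++ (r′ ++ l′)) (mapB-++ just⊗just (mapB (a ,_) (GW b)) (mapB (_, b) (GW a))) ⟨
    mapB just⊗just (idG+Gid (a , b)) ++ (r′ ++ l′)
      ∎
    where
    open ≋-Reasoning
    open ++-Solver
    r = (1# , just (b ++ [ 𝐜 ]))
    l = (1# , just (a ++ [ 𝐜 ]))
    r′ = just a ⊗̂ just (b ++ [ 𝐜 ])
    l′ = just (a ++ [ 𝐜 ]) ⊗̂ just b
    x = mapB just⊗just (mapB (a ,_) (GW b))
    y = mapB just⊗just (mapB (_, b) (GW a))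

  IdG+GId-on-F⊗F : ∀ q → ext IdGplusGId (mapB just⊗just q) ≋
    mapB just⊗just (ext idG+Gid q) ++ (mapB just⊗just (mapB (_▹ [ 𝐜 ]) q) ++ mapB just⊗just (mapB _·𝐜⊗1 q))
  IdG+GId-on-F⊗F q = begin
    ext IdGplusGId (mapB just⊗just q)
      ≡⟨ ext-mapB IdGplusGId just⊗just q ⟩
    ext (IdGplusGId ∘ just⊗just) q
      ≈⟨ ext-congˡ IdG+GId-just⊗just q ⟩
    ext (λ t → mapB just⊗just (idG+Gid t) ++ (r t ++ l t)) q
      ≈⟨ ext-++ᶠ (mapB just⊗just ∘ idG+Gid) (λ t → r t ++ l t) q ⟩
    ext (mapB just⊗just ∘ idG+Gid) q ++ ext (λ t → r t ++ l t) q
      ≈⟨ ++⁺ (≡⇒≋ (≡.sym (mapB-ext just⊗just idG+Gid q)))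
             (≋-trans (ext-++ᶠ r l q)
                      (++⁺ (ext-unit-singleton (just⊗just ∘ (_▹ [ 𝐜 ])) q)
                           (ext-unit-singleton (just⊗just ∘ _·𝐜⊗1) q))) ⟩
    mapB just⊗just (ext idG+Gid q) ++ (mapB (just⊗just ∘ (_▹ [ 𝐜 ])) q ++ mapB (just⊗just ∘ _·𝐜⊗1) q)
      ≡⟨ ≡.cong (mapB just⊗just (ext idG+Gid q) ++_) (≡.cong₂ _++_ (mapB-∘ _ _ q) (mapB-∘ _ _ q)) ⟨
    mapB just⊗just (ext idG+Gid q) ++ (mapB just⊗just (mapB (_▹ [ 𝐜 ]) q) ++ mapB just⊗just (mapB _·𝐜⊗1 q))
      ∎
    where
    open ≋-Reasoning
    r l : Word × Word → Lin (HatBasis × HatBasis)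
    r t = [ (1# , just⊗just (t ▹ [ 𝐜 ])) ]
    l t = [ (1# , just⊗just (t ·𝐜⊗1)) ]

  common-terms : Word → Lin (HatBasis × HatBasis)
  common-terms w = (mapB (𝐞 ,_) (GH (just w)) ++ mapB (_, 𝐞) (GH (just w)))
                 ++ mapB just⊗just (mapB (_▹ [ 𝐜 ]) (ΔW w) ++ w ⊗ [])

  Δ̂∘Ĝ-on-F : ∀ w → ext ΔH (GH (just w)) ≋ mapB just⊗just (Δ∘G w ++ w ⊗ []) ++ common-terms w
  Δ̂∘Ĝ-on-F w = begin
    ext ΔH (mapB just (GW w) ++ [ (1# , just w𝐜) ])
      ≡⟨ ext-++ ΔH (mapB just (GW w)) [ (1# , just w𝐜) ] ⟩
    ext ΔH (mapB just (GW w)) ++ ext ΔH [ (1# , just w𝐜) ]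
      ≈⟨ ++⁺ (Δ̂-on-F (GW w))
             (≋-trans (ext-unit-coefficients ΔH [ just w𝐜 ])
                      (≋-trans (≡⇒≋ (List.++-identityʳ (ΔH (just w𝐜)))) (Δ̂-just-++𝐜 w))) ⟩
    (ΔG ++ (eĜ ++ Ĝe)) ++ ((Δw·1⊗𝐜 ++ (w⊗1 ++ w⊗1)) ++ (𝐞 ⊗̂ just w𝐜 ++ just w𝐜 ⊗̂ 𝐞))
      ≈⟨ solve 7 (λ a b c d z u v →
             (a ⊕ (b ⊕ c)) ⊕ ((d ⊕ (z ⊕ z)) ⊕ (u ⊕ v)) ⊜ (a ⊕ z) ⊕ (((b ⊕ u) ⊕ (c ⊕ v)) ⊕ (d ⊕ z)))
           ≋-refl ΔG eĜ Ĝe Δw·1⊗𝐜 w⊗1 (𝐞 ⊗̂ just w𝐜) (just w𝐜 ⊗̂ 𝐞) ⟩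
    (ΔG ++ w⊗1) ++ (((eĜ ++ 𝐞 ⊗̂ just w𝐜) ++ (Ĝe ++ just w𝐜 ⊗̂ 𝐞)) ++ (Δw·1⊗𝐜 ++ w⊗1))
      ≡⟨ ≡.cong₂ _++_ (mapB-++ just⊗just (Δ∘G w) (w ⊗ []))
           (≡.cong₂ _++_ (≡.cong₂ _++_ (mapB-++ (𝐞 ,_) (mapB just (GW w)) [ (1# , just w𝐜) ])
                                      (mapB-++ (_, 𝐞) (mapB just (GW w)) [ (1# , just w𝐜) ]))
                         (mapB-++ just⊗just (mapB (_▹ [ 𝐜 ]) (ΔW w)) (w ⊗ []))) ⟨
    mapB just⊗just (Δ∘G w ++ w ⊗ []) ++ common-terms w
      ∎
    where
    open ≋-Reasoning
    open ++-Solver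
    w𝐜 = w ++ [ 𝐜 ]
    w⊗1 = just w ⊗̂ just []
    ΔG = mapB just⊗just (Δ∘G w)
    Δw·1⊗𝐜 = mapB just⊗just (mapB (_▹ [ 𝐜 ]) (ΔW w))
    eĜ = mapB (𝐞 ,_) (mapB just (GW w))
    Ĝe = mapB (_, 𝐞) (mapB just (GW w))

  IdG+GId∘Δ̂-on-F : ∀ w → ext IdGplusGId (ΔH (just w)) ≋
    mapB just⊗just (idG+Gid∘Δ w ++ (mapB _·𝐜⊗1 (ΔW w) ++ [] ⊗ w)) ++ common-terms w
  IdG+GId∘Δ̂-on-F w = begin
    ext IdGplusGId (mapB just⊗just (ΔW w) ++ (𝐞 ⊗̂ just w ++ just w ⊗̂ 𝐞))
      ≡⟨ ext-++ IdGplusGId (mapB just⊗just (ΔW w)) (𝐞 ⊗̂ just w ++ just w ⊗̂ 𝐞) ⟩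
    ext IdGplusGId (mapB just⊗just (ΔW w)) ++ ext IdGplusGId (𝐞 ⊗̂ just w ++ just w ⊗̂ 𝐞)
      ≈⟨ ++⁺ (IdG+GId-on-F⊗F (ΔW w)) (ext-unit-coefficients IdGplusGId ((𝐞 , just w) ∷ (just w , 𝐞) ∷ [])) ⟩
    (TΔ ++ (Δw·1⊗𝐜 ++ Δw·𝐜⊗1)) ++ ((eĜ ++ 1⊗w) ++ ((w⊗1 ++ Ĝe) ++ []))
      ≈⟨ solve 7 (λ a b c e y z g →
             (a ⊕ (b ⊕ c)) ⊕ ((e ⊕ y) ⊕ ((z ⊕ g) ⊕ id)) ⊜ (a ⊕ (c ⊕ y)) ⊕ ((e ⊕ g) ⊕ (b ⊕ z)))
           ≋-refl TΔ Δw·1⊗𝐜 Δw·𝐜⊗1 eĜ 1⊗w w⊗1 Ĝe ⟩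
    (TΔ ++ (Δw·𝐜⊗1 ++ 1⊗w)) ++ ((eĜ ++ Ĝe) ++ (Δw·1⊗𝐜 ++ w⊗1))
      ≡⟨ ≡.cong₂ _++_
           (≡.trans (mapB-++ just⊗just (idG+Gid∘Δ w) (mapB _·𝐜⊗1 (ΔW w) ++ [] ⊗ w))
                    (≡.cong (TΔ ++_) (mapB-++ just⊗just (mapB _·𝐜⊗1 (ΔW w)) ([] ⊗ w))))
           (≡.cong ((eĜ ++ Ĝe) ++_) (mapB-++ just⊗just (mapB (_▹ [ 𝐜 ]) (ΔW w)) (w ⊗ []))) ⟨
    mapB just⊗just (idG+Gid∘Δ w ++ (mapB _·𝐜⊗1 (ΔW w) ++ [] ⊗ w)) ++ common-terms w
      ∎
    where
    open ≋-Reasoning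
    open ++-Solver
    1⊗w = just [] ⊗̂ just w
    w⊗1 = just w ⊗̂ just []
    TΔ = mapB just⊗just (idG+Gid∘Δ w)
    Δw·1⊗𝐜 = mapB just⊗just (mapB (_▹ [ 𝐜 ]) (ΔW w))
    Δw·𝐜⊗1 = mapB just⊗just (mapB _·𝐜⊗1 (ΔW w))
    eĜ = mapB (𝐞 ,_) (GH (just w))
    Ĝe = mapB (_, 𝐞) (GH (just w))

  Δ̂∘Ĝ-on-basis : ∀ h → ext ΔH (GH h) ≋ ext IdGplusGId (ΔH h)
  Δ̂∘Ĝ-on-basis nothing = ≋-refl
  Δ̂∘Ĝ-on-basis (just w) = begin
    ext ΔH (GH (just w))
      ≈⟨ Δ̂∘Ĝ-on-F w ⟩
    mapB just⊗just (Δ∘G w ++ w ⊗ []) ++ common-terms w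
      ≈⟨ ++⁺ (mapB-cong just⊗just (Δ∘G-on-words w)) ≋-refl ⟩
    mapB just⊗just (idG+Gid∘Δ w ++ (mapB _·𝐜⊗1 (ΔW w) ++ [] ⊗ w)) ++ common-terms w
      ≈⟨ IdG+GId∘Δ̂-on-F w ⟨
    ext IdGplusGId (ΔH (just w))
      ∎
    where open ≋-Reasoning

  Δ̂∘Ĝ≋IdG+GId∘Δ̂ : ∀ x → Δ̂ (Ĝ x) ≋ IdG+GId (Δ̂ x)
  Δ̂∘Ĝ≋IdG+GId∘Δ̂ x = begin
    ext ΔH (ext GH x)                  ≈⟨ ext-ext ΔH GH x ⟩
    ext (ext ΔH ∘ GH) x                ≈⟨ ext-congˡ Δ̂∘Ĝ-on-basis x ⟩
    ext (ext IdGplusGId ∘ ΔH) x        ≈⟨ ext-ext IdGplusGId ΔH x ⟨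
    ext IdGplusGId (ext ΔH x)          ∎
    where open ≋-Reasoning

theorem2p3 : ∀ {c ℓ} (k : CommutativeRing c ℓ) → IsField k → CharZero k →
    ∀ (x : FreeAlg.Lin k HatBasis) →
      FreeAlg._≈⊗_ k (FreeAlg.Δ̂ k (FreeAlg.Ĝ k x)) (FreeAlg.IdG+GId k (FreeAlg.Δ̂ k x))
theorem2p3 k _ _ x = ≋⇒coeff≈ k _≟HH_ (Δ̂∘Ĝ≋IdG+GId∘Δ̂ k x)
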